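{- Let $\lambda=(\lambda_1,\dots,\lambda_l)$ be a strict partition of length $l$. Then $$P_\lambda=\sum_{j_1=1}^{\lambda_1}\cdots\sum_{j_l=1}^{\lambda_l}T(\lambda_1,j_1)\cdots T(\lambda_l,j_l)\,P^*_{(j_1,\dots,j_l)},$$ where $P^*_{(j_1,\dots,j_l)}=0$ if $j_1,\dots,j_l$ are not pairwise distinct, and $P^*_{(j_1,\dots,j_l)}=(\operatorname{sgn}\pi)P^*_\mu$ if $(j_1,\dots,j_l)=(\mu_{\pi(1)},\dots,\mu_{\pi(l)})$ for a strict partition $\mu=(\mu_1,\dots,\mu_l)$ of length $l$ and a permutation $\pi\in S_l$.
   Context: For a variable $x$ and integer $k\ge1$, $x^{\downarrow k}=x(x-1)\cdots(x-k+1)$, $x^{\downarrow0}=1$. The Stirling numbers of the second kind $T(k,j)$ are defined by $x^k=\sum_{j=1}^kT(k,j)x^{\downarrow j}$. A strict partition is a strictly decreasing finite sequence of positive integers. For a strict partition $\lambda$ of length $l$, the Schur $P$-function $P_\lambda$ is the symmetric function given in $N\ge l$ variables by $P_\lambda(x_1,\dots,x_N)=\frac{1}{(N-l)!}\sum_{\omega\in S_N}\omega\Big(x_1^{\lambda_1}\cdots x_l^{\lambda_l}\prod_{1\le i\le l,\ i<j\le N}\frac{x_i+x_j}{x_i-x_j}\Big)$ (and $0$ for $N<l$), where $S_N$ permutes the variables; the factorial Schur $P$-function $P^*_\lambda$ is defined by the same formula with $x_i^{\lambda_i}$ replaced by $x_i^{\downarrow\lambda_i}$. (These families are consistent in $N$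 and define symmetric functions.) -}

module Defs where

open import Data.Bool using (Bool; true; false; _∧_; if_then_else_)
open import Data.Nat as ℕ using (ℕ; zero; suc; _∸_; _!; _<ᵇ_; _≡ᵇ_)
open import Data.Nat.Properties using (_!≢0)
open import Data.Integer using (+_)
open import Data.List using (List; []; _∷_; map; concatMap; length; applyUpTo; foldr)
open import Data.List.Relation.Unary.All using (All)
open import Relation.Nullary using (yes; no)
open import Data.Product using (_×_)
import Data.Rational.Properties as ℚP
open import Data.List.Relation.Unary.Linked using (Linked)
open import Data.Rational as ℚ using (ℚ; 0ℚ; 1ℚ; _+_; _*_; _-_; -_; _/_)

ℕtoℚ : ℕ → ℚ
ℕtoℚ n = (+ n) / 1

pow : ℚ → ℕ → ℚ
pow x zero    = 1ℚ
pow x (suc k) = x * pow x k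

falling : ℚ → ℕ → ℚ
falling x zero    = 1ℚ
falling x (suc k) = falling x k * (x - ℕtoℚ k)

-- Division; only ever applied (in the statement) with a nonzero
-- denominator x_i - x_j for distinct x_i, x_j.  Returns 0 when q = 0.
_÷'_ : ℚ → ℚ → ℚ
p ÷' q with q ℚP.≟ 0ℚ
... | yes _ = 0ℚ
... | no q≢0 = ℚ._÷_ p q {{ℚ.≢-nonZero q≢0}}

sumℚ : List ℚ → ℚ
sumℚ = foldr _+_ 0ℚ

prodℚ : List ℚ → ℚ
prodℚ = foldr _*_ 1ℚ

StrictPartition : List ℕ → Set
StrictPartition λs = Linked ℕ._>_ λs × All (ℕ._<_ 0) λs

-- Stirling numbers of the second kind T(k,j), characterised by
-- x^k = Σ_j T(k,j) x^{↓j}; given by the standard recurrence.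

T : ℕ → ℕ → ℕ
T zero    zero    = 1
T zero    (suc j) = 0
T (suc k) zero    = 0
T (suc k) (suc j) = suc j ℕ.* T k (suc j) ℕ.+ T k j

-- All orderings (y_1,...,y_N) = (x_{ω(1)},...,x_{ω(N)}), ω ∈ S_N,
-- of a list (x_1,...,x_N): one list per permutation ω (N! lists).

insertions : {A : Set} → A → List A → List (List A)
insertions x []       = (x ∷ []) ∷ []
insertions x (y ∷ ys) = (x ∷ y ∷ ys) ∷ map (y ∷_) (insertions x ys)

permutations : {A : Set} → List A → List (List A)
permutations []       = [] ∷ []
permutations (x ∷ xs) = concatMap (insertions x) (permutations xs)

-- The summand  y_1^{[λ_1]} ... y_l^{[λ_l]} ∏_{1≤i≤l, i<j≤N} (y_i+y_j)/(y_i-y_j)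
-- where y^{[k]} is given by the parameter `pw` (power or falling factorial).

summand : (ℚ → ℕ → ℚ) → List ℕ → List ℚ → ℚ
summand pw []        ys       = 1ℚ
summand pw (a ∷ λs)  []       = 0ℚ   -- not used: only when N < l
summand pw (a ∷ λs)  (y ∷ ys) =
  pw y a * prodℚ (map (λ z → (y + z) ÷' (y - z)) ys) * summand pw λs ys

symmetrize : (ℚ → ℕ → ℚ) → List ℕ → List ℚ → ℚ
symmetrize pw λs xs =
  if length xs <ᵇ length λs then 0ℚ
  else (_/_ (+ 1) ((length xs ∸ length λs) !) {{(length xs ∸ length λs) !≢0}})
       * sumℚ (map (summand pw λs) (permutations xs))

SchurP : List ℕ → List ℚ → ℚ
SchurP = symmetrize pow

SchurP* : List ℕ → List ℚ → ℚ
SchurP* = symmetrize falling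

notIn : ℕ → List ℕ → Bool
notIn a []       = true
notIn a (b ∷ bs) = if a ≡ᵇ b then false else notIn a bs

allDistinct : List ℕ → Bool
allDistinct []       = true
allDistinct (a ∷ as) = notIn a as ∧ allDistinct as

insertDesc : ℕ → List ℕ → List ℕ
insertDesc a []       = a ∷ []
insertDesc a (b ∷ bs) = if b <ᵇ a then a ∷ b ∷ bs else b ∷ insertDesc a bs

sortDesc : List ℕ → List ℕ
sortDesc = foldr insertDesc []

-- number of inversions of (j_1,...,j_l) w.r.t. decreasing order:
-- #{a < b : j_a < j_b}; equals the number of inversions of π when
-- (j_1,...,j_l) = (μ_{π(1)},...,μ_{π(l)}) with μ strictly decreasing.
countLess : ℕ → List ℕ → ℕ
countLess a []       = 0
countLess a (b ∷ bs) = (if a <ᵇ b then 1 else 0) ℕ.+ countLess a bs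

inversions : List ℕ → ℕ
inversions []       = 0
inversions (a ∷ as) = countLess a as ℕ.+ inversions as

sgnℚ : ℕ → ℚ
sgnℚ n = pow (- 1ℚ) n

SchurP*gen : List ℕ → List ℚ → ℚ
SchurP*gen js xs =
  if allDistinct js then sgnℚ (inversions js) * SchurP* (sortDesc js) xs
  else 0ℚ

boxes : List ℕ → List (List ℕ)
boxes []       = [] ∷ []
boxes (a ∷ as) = concatMap (λ j → map (j ∷_) (boxes as)) (applyUpTo suc a)

stirlingProd : List ℕ → List ℕ → ℚ
stirlingProd (a ∷ as) (j ∷ js) = ℕtoℚ (T a j) * stirlingProd as js
stirlingProd _        _        = 1ℚ

rhs : List ℕ → List ℚ → ℚ
rhs λs xs = sumℚ (map (λ js → stirlingProd λs js * SchurP*gen js xs) (boxes λs))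

-- Expanding every power in the Stirling basis, x^k = Σ_j T(k,j) x^{↓j}, turns each summand
-- of the symmetrization defining P_λ into the combination, with coefficients
-- T(λ_1,j_1)⋯T(λ_l,j_l) independent of the permutation, of the summands defining
-- P*_{(j_1,…,j_l)}; summing over permutations gives P_λ = Σ_j T⋯T P*_{(j)} for tuples j.
-- Exchanging j_i and j_{i+1} while composing with the transposition of the i-th and
-- (i+1)-th variables flips the sign of the factor (x_a+x_b)/(x_a−x_b) of that pair and
-- only permutes the others, so the tuple-indexed P* is alternating. An alternating function
-- vanishes on tuples with a repetition and otherwise equals the sign of the sorting
-- permutation times its value at the decreasingly sorted tuple, which is the stated
-- convention.

module Submission where

open import Defs
open import Function using (_∘_; Equivalence)
open import Data.Bool as Bool using (true; false; if_then_else_; _∧_)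
open import Data.Bool.Properties using (T-≡; ¬-not)
open import Data.Nat as ℕ using (ℕ; zero; suc; _∸_; _!; _<ᵇ_; _≡ᵇ_; _≤_; _<_; _≥_; s≤s)
import Data.Nat.Properties as ℕP
open import Data.Nat.Properties using (_!≢0)
open import Data.Integer as ℤ using (+[1+_]; -[1+_])
import Data.Integer.Properties as ℤP
open import Data.Rational as ℚ using (ℚ; mkℚ; 0ℚ; 1ℚ; ½; _+_; _*_; _-_; -_; _/_)
import Data.Rational.Properties as ℚP
import Data.Rational.Unnormalised as ℚᵘ
import Data.Rational.Unnormalised.Properties as ℚᵘP
open import Algebra.Properties.Group ℚP.+-0-group using (∙-cancelʳ)
open import Data.Rational.Solver using (module +-*-Solver)
open import Algebra.Properties.CommutativeSemigroup ℕP.+-commutativeSemigroup using (x∙yz≈y∙xz)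
open import Data.Product using (_×_; _,_)
open import Data.List using (List; []; _∷_; map; concatMap; _++_; [_]; length; upTo; applyUpTo)
open import Data.List.Properties
  using (map-++; map-∘; map-cong; map-cong-local; map-upTo; map-applyUpTo; upTo-∷ʳ; length-++)
open import Data.List.Relation.Unary.All as All using (All; []; _∷_)
open import Data.List.Relation.Unary.All.Properties using (concat⁺; map⁺)
open import Data.List.Relation.Unary.AllPairs using (AllPairs; []; _∷_)
open import Data.List.Relation.Unary.Unique.Propositional using (Unique)
open import Relation.Binary.PropositionalEquality hiding ([_])
open import Relation.Binary.Definitions using (tri<; tri≈; tri>)
open import Relation.Nullary using (yes; no; contradiction)
open +-*-Solver

fromℚᵘ-homo-+ : ∀ p q → ℚ.fromℚᵘ (p ℚᵘ.+ q) ≡ ℚ.fromℚᵘ p + ℚ.fromℚᵘ q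
fromℚᵘ-homo-+ p q = ℚP.toℚᵘ-injective (ℚᵘP.≃-trans (ℚP.toℚᵘ-fromℚᵘ (p ℚᵘ.+ q))
  (ℚᵘP.≃-sym (ℚᵘP.≃-trans (ℚP.toℚᵘ-homo-+ (ℚ.fromℚᵘ p) (ℚ.fromℚᵘ q))
    (ℚᵘP.+-cong (ℚP.toℚᵘ-fromℚᵘ p) (ℚP.toℚᵘ-fromℚᵘ q)))))

fromℚᵘ-homo-* : ∀ p q → ℚ.fromℚᵘ (p ℚᵘ.* q) ≡ ℚ.fromℚᵘ p * ℚ.fromℚᵘ q
fromℚᵘ-homo-* p q = ℚP.toℚᵘ-injective (ℚᵘP.≃-trans (ℚP.toℚᵘ-fromℚᵘ (p ℚᵘ.* q))
  (ℚᵘP.≃-sym (ℚᵘP.≃-trans (ℚP.toℚᵘ-homo-* (ℚ.fromℚᵘ p) (ℚ.fromℚᵘ q))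
    (ℚᵘP.*-cong (ℚP.toℚᵘ-fromℚᵘ p) (ℚP.toℚᵘ-fromℚᵘ q)))))

ℕtoℚ-+ : ∀ m n → ℕtoℚ (m ℕ.+ n) ≡ ℕtoℚ m + ℕtoℚ n
ℕtoℚ-+ m n = trans (cong (λ k → k / 1) eq)
  (fromℚᵘ-homo-+ (ℚᵘ.mkℚᵘ (ℤ.+ m) 0) (ℚᵘ.mkℚᵘ (ℤ.+ n) 0))
  where
  eq : ℤ.+ (m ℕ.+ n) ≡ ℤ.+ m ℤ.* ℤ.+ 1 ℤ.+ ℤ.+ n ℤ.* ℤ.+ 1
  eq = trans (ℤP.pos-+ m n) (sym (cong₂ ℤ._+_ (ℤP.*-identityʳ (ℤ.+ m)) (ℤP.*-identityʳ (ℤ.+ n))))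

ℕtoℚ-* : ∀ m n → ℕtoℚ (m ℕ.* n) ≡ ℕtoℚ m * ℕtoℚ n
ℕtoℚ-* m n = trans (cong (λ k → k / 1) (ℤP.pos-* m n))
  (fromℚᵘ-homo-* (ℚᵘ.mkℚᵘ (ℤ.+ m) 0) (ℚᵘ.mkℚᵘ (ℤ.+ n) 0))

pow-+ : ∀ x m n → pow x (m ℕ.+ n) ≡ pow x m * pow x n
pow-+ x zero    n = sym (ℚP.*-identityˡ (pow x n))
pow-+ x (suc m) n = trans (cong (x *_) (pow-+ x m n)) (sym (ℚP.*-assoc x (pow x m) (pow x n)))

x≡-x⇒x≡0 : ∀ x → x ≡ - x → x ≡ 0ℚ
x≡-x⇒x≡0 x x≡-x = begin
  x                ≡⟨ solve 1 (λ y → y := con ½ :* (y :+ y)) refl x ⟩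
  ½ * (x + x)      ≡⟨ cong (λ y → ½ * (x + y)) x≡-x ⟩
  ½ * (x + - x)    ≡⟨ solve 1 (λ y → con ½ :* (y :+ :- y) := con 0ℚ) refl x ⟩
  0ℚ               ∎
  where
  open ≡-Reasoning

1/-neg : ∀ q .{{_ : ℚ.NonZero q}} .{{_ : ℚ.NonZero (- q)}} → ℚ.1/ (- q) ≡ - ℚ.1/ q
1/-neg (mkℚ +[1+ n ] d _) = refl
1/-neg (mkℚ -[1+ n ] d _) = refl

÷'-neg : ∀ p q → p ÷' (- q) ≡ - (p ÷' q)
÷'-neg p q with q ℚP.≟ 0ℚ | (- q) ℚP.≟ 0ℚ
... | yes _    | yes _      = refl
... | yes refl | no -q≢0    = contradiction refl -q≢0
... | no q≢0   | yes -q≡0   = contradiction (ℚP.neg-injective -q≡0) q≢0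
... | no q≢0   | no -q≢0    = trans (cong (p *_) (1/-neg q {{ℚ.≢-nonZero q≢0}} {{ℚ.≢-nonZero -q≢0}}))
                                    (sym (ℚP.neg-distribʳ-* p _))

sumℚ-++ : ∀ (xs ys : List ℚ) → sumℚ (xs ++ ys) ≡ sumℚ xs + sumℚ ys
sumℚ-++ []       ys = sym (ℚP.+-identityˡ (sumℚ ys))
sumℚ-++ (x ∷ xs) ys = trans (cong (x +_) (sumℚ-++ xs ys)) (sym (ℚP.+-assoc x (sumℚ xs) (sumℚ ys)))

module _ {A : Set} where

  sumℚ-cong : ∀ {f g : A → ℚ} → f ≗ g → ∀ xs → sumℚ (map f xs) ≡ sumℚ (map g xs)
  sumℚ-cong f≗g xs = cong sumℚ (map-cong f≗g xs)

  sumℚ-map-0 : ∀ {f : A → ℚ} → (∀ x → f x ≡ 0ℚ) → ∀ xs → sumℚ (map f xs) ≡ 0ℚ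
  sumℚ-map-0 f≗0 []       = refl
  sumℚ-map-0 f≗0 (x ∷ xs) = cong₂ _+_ (f≗0 x) (sumℚ-map-0 f≗0 xs)

  sumℚ-map-+ : ∀ (f g : A → ℚ) xs → sumℚ (map (λ x → f x + g x) xs) ≡ sumℚ (map f xs) + sumℚ (map g xs)
  sumℚ-map-+ f g []       = refl
  sumℚ-map-+ f g (x ∷ xs) = trans (cong (f x + g x +_) (sumℚ-map-+ f g xs))
    (solve 4 (λ a b c d → (a :+ b) :+ (c :+ d) := (a :+ c) :+ (b :+ d)) refl (f x) (g x) _ _)

  sumℚ-map-*ˡ : ∀ c (f : A → ℚ) xs → sumℚ (map (λ x → c * f x) xs) ≡ c * sumℚ (map f xs)
  sumℚ-map-*ˡ c f []       = sym (ℚP.*-zeroʳ c)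
  sumℚ-map-*ˡ c f (x ∷ xs) = trans (cong (c * f x +_) (sumℚ-map-*ˡ c f xs))
    (sym (ℚP.*-distribˡ-+ c (f x) _))

  sumℚ-map-*ʳ : ∀ c (f : A → ℚ) xs → sumℚ (map (λ x → f x * c) xs) ≡ sumℚ (map f xs) * c
  sumℚ-map-*ʳ c f []       = sym (ℚP.*-zeroˡ c)
  sumℚ-map-*ʳ c f (x ∷ xs) = trans (cong (f x * c +_) (sumℚ-map-*ʳ c f xs))
    (sym (ℚP.*-distribʳ-+ c (f x) _))

  sumℚ-map-neg : ∀ (f : A → ℚ) xs → sumℚ (map (λ x → - f x) xs) ≡ - sumℚ (map f xs)
  sumℚ-map-neg f []       = refl
  sumℚ-map-neg f (x ∷ xs) = trans (cong (- f x +_) (sumℚ-map-neg f xs))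
    (sym (ℚP.neg-distrib-+ (f x) _))

module _ {A B : Set} where

  sumℚ-map-concatMap : ∀ (f : B → ℚ) (g : A → List B) xs →
    sumℚ (map f (concatMap g xs)) ≡ sumℚ (map (λ x → sumℚ (map f (g x))) xs)
  sumℚ-map-concatMap f g []       = refl
  sumℚ-map-concatMap f g (x ∷ xs) = begin
    sumℚ (map f (g x ++ concatMap g xs))
      ≡⟨ cong sumℚ (map-++ f (g x) _) ⟩
    sumℚ (map f (g x) ++ map f (concatMap g xs))
      ≡⟨ sumℚ-++ (map f (g x)) _ ⟩
    sumℚ (map f (g x)) + sumℚ (map f (concatMap g xs))
      ≡⟨ cong (sumℚ (map f (g x)) +_) (sumℚ-map-concatMap f g xs) ⟩
    sumℚ (map f (g x)) + sumℚ (map (λ x → sumℚ (map f (g x))) xs) ∎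
    where open ≡-Reasoning

  sumℚ-map-∘ : ∀ (f : B → ℚ) (g : A → B) xs → sumℚ (map f (map g xs)) ≡ sumℚ (map (f ∘ g) xs)
  sumℚ-map-∘ f g xs = sym (cong sumℚ (map-∘ xs))

  sumℚ-comm : ∀ (h : A → B → ℚ) xs ys →
    sumℚ (map (λ x → sumℚ (map (h x) ys)) xs) ≡ sumℚ (map (λ y → sumℚ (map (λ x → h x y) xs)) ys)
  sumℚ-comm h []       ys = sym (sumℚ-map-0 (λ _ → refl) ys)
  sumℚ-comm h (x ∷ xs) ys = trans (cong (sumℚ (map (h x) ys) +_) (sumℚ-comm h xs ys))
    (sym (sumℚ-map-+ (h x) (λ y → sumℚ (map (λ x → h x y) xs)) ys))

  sumℚ-*-sumℚ : ∀ (u : A → ℚ) (v : B → ℚ) xs ys →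
    sumℚ (map u xs) * sumℚ (map v ys) ≡ sumℚ (map (λ x → sumℚ (map (λ y → u x * v y) ys)) xs)
  sumℚ-*-sumℚ u v xs ys = begin
    sumℚ (map u xs) * sumℚ (map v ys)
      ≡⟨ sumℚ-map-*ʳ (sumℚ (map v ys)) u xs ⟨
    sumℚ (map (λ x → u x * sumℚ (map v ys)) xs)
      ≡⟨ sumℚ-cong (λ x → sumℚ-map-*ˡ (u x) v ys) xs ⟨
    sumℚ (map (λ x → sumℚ (map (λ y → u x * v y) ys)) xs) ∎
    where open ≡-Reasoning

permSum : {A : Set} → List A → (List A → ℚ) → ℚ
permSum xs g = sumℚ (map g (permutations xs))

module _ {A : Set} where

  insertionSum : A → (List A → ℚ) → List A → ℚ
  insertionSum x g ys = sumℚ (map g (insertions x ys))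

  permSum-∷ : ∀ x xs (g : List A → ℚ) → permSum (x ∷ xs) g ≡ permSum xs (insertionSum x g)
  permSum-∷ x xs g = sumℚ-map-concatMap g (insertions x) (permutations xs)

  permSum-cong : ∀ xs {f g : List A → ℚ} → f ≗ g → permSum xs f ≡ permSum xs g
  permSum-cong xs f≗g = sumℚ-cong f≗g (permutations xs)

  swapHead : List A → List A
  swapHead (a ∷ b ∷ r) = b ∷ a ∷ r
  swapHead l           = l

  swapAt : ℕ → List A → List A
  swapAt zero    ys      = swapHead ys
  swapAt (suc k) []      = []
  swapAt (suc k) (y ∷ r) = y ∷ swapAt k r

  lateInsertionSum : A → (List A → ℚ) → List A → ℚ
  lateInsertionSum x g (y ∷ y′ ∷ r) = insertionSum x (λ w → g (y ∷ y′ ∷ w)) r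
  lateInsertionSum x g _            = 0ℚ

  insertionSum-∷∷ : ∀ x (g : List A → ℚ) y y′ r → insertionSum x g (y ∷ y′ ∷ r) ≡
    g (x ∷ y ∷ y′ ∷ r) + g (y ∷ x ∷ y′ ∷ r) + lateInsertionSum x g (y ∷ y′ ∷ r)
  insertionSum-∷∷ x g y y′ r = begin
    g (x ∷ y ∷ y′ ∷ r) + (g (y ∷ x ∷ y′ ∷ r) + sumℚ (map g (map (y ∷_) (map (y′ ∷_) ins))))
      ≡⟨ cong (λ s → g (x ∷ y ∷ y′ ∷ r) + (g (y ∷ x ∷ y′ ∷ r) + s)) late ⟩
    g (x ∷ y ∷ y′ ∷ r) + (g (y ∷ x ∷ y′ ∷ r) + lateInsertionSum x g (y ∷ y′ ∷ r))
      ≡⟨ ℚP.+-assoc (g (x ∷ y ∷ y′ ∷ r)) (g (y ∷ x ∷ y′ ∷ r)) _ ⟨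
    g (x ∷ y ∷ y′ ∷ r) + g (y ∷ x ∷ y′ ∷ r) + lateInsertionSum x g (y ∷ y′ ∷ r) ∎
    where
    open ≡-Reasoning
    ins = insertions x r
    late : sumℚ (map g (map (y ∷_) (map (y′ ∷_) ins))) ≡ lateInsertionSum x g (y ∷ y′ ∷ r)
    late = trans (sumℚ-map-∘ g (y ∷_) (map (y′ ∷_) ins)) (sumℚ-map-∘ (g ∘ (y ∷_)) (y′ ∷_) ins)

  -- Swapping the first two entries exchanges the two insertions of x in front of them; the
  -- remaining insertions become insertions into the swapped list.
  insertionSum-swapHead : ∀ x (g : List A → ℚ) ys →
    insertionSum x (g ∘ swapHead) ys + lateInsertionSum x g ys ≡
    insertionSum x g ys + lateInsertionSum x g (swapHead ys)
  insertionSum-swapHead x g []           = refl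
  insertionSum-swapHead x g (y ∷ [])     =
    solve 2 (λ a b → (a :+ (b :+ con 0ℚ)) :+ con 0ℚ := (b :+ (a :+ con 0ℚ)) :+ con 0ℚ) refl
      (g (y ∷ x ∷ [])) (g (x ∷ y ∷ []))
  insertionSum-swapHead x g (y ∷ y′ ∷ r) = begin
    insertionSum x (g ∘ swapHead) (y ∷ y′ ∷ r) + late y y′
      ≡⟨ cong (_+ late y y′) (insertionSum-∷∷ x (g ∘ swapHead) y y′ r) ⟩
    g (y ∷ x ∷ y′ ∷ r) + g (x ∷ y ∷ y′ ∷ r) + late y′ y + late y y′
      ≡⟨ solve 4 (λ a b c d → a :+ b :+ c :+ d := b :+ a :+ d :+ c) refl
           (g (y ∷ x ∷ y′ ∷ r)) (g (x ∷ y ∷ y′ ∷ r)) (late y′ y) (late y y′) ⟩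
    g (x ∷ y ∷ y′ ∷ r) + g (y ∷ x ∷ y′ ∷ r) + late y y′ + late y′ y
      ≡⟨ cong (_+ late y′ y) (insertionSum-∷∷ x g y y′ r) ⟨
    insertionSum x g (y ∷ y′ ∷ r) + late y′ y ∎
    where
    open ≡-Reasoning
    late : A → A → ℚ
    late a b = lateInsertionSum x g (a ∷ b ∷ r)

  permSum-swapHead : ∀ xs (g : List A → ℚ) → permSum xs (g ∘ swapHead) ≡ permSum xs g
  permSum-swapHead []       g = refl
  permSum-swapHead (x ∷ xs) g = begin
    permSum (x ∷ xs) (g ∘ swapHead)             ≡⟨ permSum-∷ x xs (g ∘ swapHead) ⟩
    permSum xs (insertionSum x (g ∘ swapHead))  ≡⟨ ∙-cancelʳ (permSum xs late) _ _ cancelled ⟩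
    permSum xs (insertionSum x g)               ≡⟨ permSum-∷ x xs g ⟨
    permSum (x ∷ xs) g                          ∎
    where
    open ≡-Reasoning
    late = lateInsertionSum x g
    cancelled : permSum xs (insertionSum x (g ∘ swapHead)) + permSum xs late ≡
                permSum xs (insertionSum x g) + permSum xs late
    cancelled = begin
      permSum xs (insertionSum x (g ∘ swapHead)) + permSum xs late
        ≡⟨ sumℚ-map-+ (insertionSum x (g ∘ swapHead)) late (permutations xs) ⟨
      permSum xs (λ ys → insertionSum x (g ∘ swapHead) ys + late ys)
        ≡⟨ permSum-cong xs (insertionSum-swapHead x g) ⟩
      permSum xs (λ ys → insertionSum x g ys + late (swapHead ys))
        ≡⟨ sumℚ-map-+ (insertionSum x g) (late ∘ swapHead) (permutations xs) ⟩
      permSum xs (insertionSum x g) + permSum xs (late ∘ swapHead)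
        ≡⟨ cong (permSum xs (insertionSum x g) +_) (permSum-swapHead xs late) ⟩
      permSum xs (insertionSum x g) + permSum xs late ∎

  selections : A → List A → List (A × List A)
  selections x []        = (x , []) ∷ []
  selections x (x′ ∷ xs) = (x , x′ ∷ xs) ∷ map (λ (h , rest) → h , x ∷ rest) (selections x′ xs)

  tailInsertionSum : A → (List A → ℚ) → List A → ℚ
  tailInsertionSum x g []      = 0ℚ
  tailInsertionSum x g (y ∷ r) = insertionSum x (λ w → g (y ∷ w)) r

  insertionSum-head+tail : ∀ x (g : List A → ℚ) ys →
    insertionSum x g ys ≡ g (x ∷ ys) + tailInsertionSum x g ys
  insertionSum-head+tail x g []      = refl
  insertionSum-head+tail x g (y ∷ r) = cong (g (x ∷ y ∷ r) +_) (sumℚ-map-∘ g (y ∷_) (insertions x r))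

  permSum-selections : ∀ x xs (g : List A → ℚ) →
    permSum (x ∷ xs) g ≡ sumℚ (map (λ (h , rest) → permSum rest (λ w → g (h ∷ w))) (selections x xs))
  permSum-selections x []        g = sym (ℚP.+-identityʳ _)
  permSum-selections x (x′ ∷ xs) g = begin
    permSum (x ∷ x′ ∷ xs) g
      ≡⟨ permSum-∷ x (x′ ∷ xs) g ⟩
    permSum (x′ ∷ xs) (insertionSum x g)
      ≡⟨ permSum-cong (x′ ∷ xs) (insertionSum-head+tail x g) ⟩
    permSum (x′ ∷ xs) (λ ys → g (x ∷ ys) + tailInsertionSum x g ys)
      ≡⟨ sumℚ-map-+ (λ ys → g (x ∷ ys)) (tailInsertionSum x g) (permutations (x′ ∷ xs)) ⟩
    permSum (x′ ∷ xs) (λ ys → g (x ∷ ys)) + permSum (x′ ∷ xs) (tailInsertionSum x g)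
      ≡⟨ cong (permSum (x′ ∷ xs) (λ ys → g (x ∷ ys)) +_) tails ⟩
    permSum (x′ ∷ xs) (λ ys → g (x ∷ ys)) +
      sumℚ (map F (map (λ (h , rest) → h , x ∷ rest) (selections x′ xs))) ∎
    where
    open ≡-Reasoning
    F : A × List A → ℚ
    F (h , rest) = permSum rest (λ w → g (h ∷ w))
    tails : permSum (x′ ∷ xs) (tailInsertionSum x g) ≡
            sumℚ (map F (map (λ (h , rest) → h , x ∷ rest) (selections x′ xs)))
    tails = begin
      permSum (x′ ∷ xs) (tailInsertionSum x g)
        ≡⟨ permSum-selections x′ xs (tailInsertionSum x g) ⟩
      sumℚ (map (λ (h , rest) → permSum rest (insertionSum x (λ w → g (h ∷ w)))) (selections x′ xs))
        ≡⟨ sumℚ-cong (λ (h , rest) → permSum-∷ x rest (λ w → g (h ∷ w))) (selections x′ xs) ⟨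
      sumℚ (map (λ (h , rest) → F (h , x ∷ rest)) (selections x′ xs))
        ≡⟨ sumℚ-map-∘ F (λ (h , rest) → h , x ∷ rest) (selections x′ xs) ⟨
      sumℚ (map F (map (λ (h , rest) → h , x ∷ rest) (selections x′ xs))) ∎

  permSum-swapAt : ∀ k xs (g : List A → ℚ) → permSum xs (g ∘ swapAt k) ≡ permSum xs g
  permSum-swapAt zero    xs       g = permSum-swapHead xs g
  permSum-swapAt (suc k) []       g = refl
  permSum-swapAt (suc k) (x ∷ xs) g = begin
    permSum (x ∷ xs) (g ∘ swapAt (suc k))
      ≡⟨ permSum-selections x xs (g ∘ swapAt (suc k)) ⟩
    sumℚ (map (λ (h , rest) → permSum rest (λ w → g (h ∷ swapAt k w))) (selections x xs))
      ≡⟨ sumℚ-cong (λ (h , rest) → permSum-swapAt k rest (λ w → g (h ∷ w))) (selections x xs) ⟩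
    sumℚ (map (λ (h , rest) → permSum rest (λ w → g (h ∷ w))) (selections x xs))
      ≡⟨ permSum-selections x xs g ⟨
    permSum (x ∷ xs) g ∎
    where open ≡-Reasoning

permSum-linear : ∀ {A B : Set} xs c (a : B → ℚ) (g : B → List A → ℚ) bs →
  c * permSum xs (λ ys → sumℚ (map (λ b → a b * g b ys) bs)) ≡
  sumℚ (map (λ b → a b * (c * permSum xs (g b))) bs)
permSum-linear xs c a g bs = begin
  c * permSum xs (λ ys → sumℚ (map (λ b → a b * g b ys) bs))
    ≡⟨ cong (c *_) (sumℚ-comm (λ ys b → a b * g b ys) (permutations xs) bs) ⟩
  c * sumℚ (map (λ b → permSum xs (λ ys → a b * g b ys)) bs)
    ≡⟨ cong (c *_) (sumℚ-cong (λ b → sumℚ-map-*ˡ (a b) (g b) (permutations xs)) bs) ⟩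
  c * sumℚ (map (λ b → a b * permSum xs (g b)) bs)
    ≡⟨ sumℚ-map-*ˡ c (λ b → a b * permSum xs (g b)) bs ⟨
  sumℚ (map (λ b → c * (a b * permSum xs (g b))) bs)
    ≡⟨ sumℚ-cong (λ b → solve 3 (λ c a p → c :* (a :* p) := a :* (c :* p)) refl
         c (a b) (permSum xs (g b))) bs ⟩
  sumℚ (map (λ b → a b * (c * permSum xs (g b))) bs) ∎
  where open ≡-Reasoning

<ᵇ-true : ∀ {m n} → m < n → (m <ᵇ n) ≡ true
<ᵇ-true m<n = Equivalence.to T-≡ (ℕP.<⇒<ᵇ m<n)

<ᵇ-false : ∀ {m n} → n ≤ m → (m <ᵇ n) ≡ false
<ᵇ-false {m} {n} n≤m = ¬-not λ m<ᵇn → ℕP.≤⇒≯ n≤m (ℕP.<ᵇ⇒< m n (Equivalence.from T-≡ m<ᵇn))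

≡ᵇ-refl : ∀ m → (m ≡ᵇ m) ≡ true
≡ᵇ-refl m = Equivalence.to T-≡ (ℕP.≡⇒≡ᵇ m m refl)

≡ᵇ-false : ∀ {m n} → m ≢ n → (m ≡ᵇ n) ≡ false
≡ᵇ-false {m} {n} m≢n = ¬-not λ m≡ᵇn → m≢n (ℕP.≡ᵇ⇒≡ m n (Equivalence.from T-≡ m≡ᵇn))

Descending : List ℕ → Set
Descending = AllPairs _≥_

All-insertDesc : ∀ {P : ℕ → Set} {a} s → P a → All P s → All P (insertDesc a s)
All-insertDesc             []      pa []         = pa ∷ []
All-insertDesc {a = a} (b ∷ s) pa (pb ∷ ps) with b <ᵇ a
... | true  = pa ∷ pb ∷ ps
... | false = pb ∷ All-insertDesc s pa ps

insertDesc-descending : ∀ a s → Descending s → Descending (insertDesc a s)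
insertDesc-descending a []      []          = [] ∷ []
insertDesc-descending a (b ∷ s) (b≥s ∷ ds) with b <ᵇ a in b<ᵇa
... | true  = (ℕP.<⇒≤ b<a ∷ All.map (λ c≤b → ℕP.≤-trans c≤b (ℕP.<⇒≤ b<a)) b≥s) ∷ b≥s ∷ ds
  where b<a = ℕP.<ᵇ⇒< b a (Equivalence.from T-≡ b<ᵇa)
... | false = All-insertDesc s a≤b b≥s ∷ insertDesc-descending a s ds
  where a≤b = ℕP.≮⇒≥ λ b<a → subst Bool.T b<ᵇa (ℕP.<⇒<ᵇ b<a)

sortDesc-descending : ∀ js → Descending (sortDesc js)
sortDesc-descending []       = []
sortDesc-descending (j ∷ js) = insertDesc-descending j (sortDesc js) (sortDesc-descending js)

module FoldInvariance {X : Set} (f : List ℕ → X) (step : ℕ → X → X)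
    (f-∷ : ∀ b s → f (b ∷ s) ≡ step b (f s))
    (step-comm : ∀ b c x → step b (step c x) ≡ step c (step b x)) where

  insertDesc-invariant : ∀ b s → f (insertDesc b s) ≡ f (b ∷ s)
  insertDesc-invariant b []      = refl
  insertDesc-invariant b (c ∷ s) with c <ᵇ b
  ... | true  = refl
  ... | false = begin
    f (c ∷ insertDesc b s)      ≡⟨ f-∷ c (insertDesc b s) ⟩
    step c (f (insertDesc b s)) ≡⟨ cong (step c) (trans (insertDesc-invariant b s) (f-∷ b s)) ⟩
    step c (step b (f s))       ≡⟨ step-comm c b (f s) ⟩
    step b (step c (f s))       ≡⟨ cong (step b) (f-∷ c s) ⟨
    step b (f (c ∷ s))          ≡⟨ f-∷ b (c ∷ s) ⟨
    f (b ∷ c ∷ s)               ∎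
    where open ≡-Reasoning

  sortDesc-invariant : ∀ js → f (sortDesc js) ≡ f js
  sortDesc-invariant []       = refl
  sortDesc-invariant (j ∷ js) = begin
    f (insertDesc j (sortDesc js)) ≡⟨ insertDesc-invariant j (sortDesc js) ⟩
    f (j ∷ sortDesc js)            ≡⟨ f-∷ j (sortDesc js) ⟩
    step j (f (sortDesc js))       ≡⟨ cong (step j) (sortDesc-invariant js) ⟩
    step j (f js)                  ≡⟨ f-∷ j js ⟨
    f (j ∷ js)                     ∎
    where open ≡-Reasoning

notIn-sortDesc : ∀ a js → notIn a (sortDesc js) ≡ notIn a js
notIn-sortDesc a = FoldInvariance.sortDesc-invariant (notIn a) (λ b r → if a ≡ᵇ b then false else r)
  (λ _ _ → refl) (λ b c r → swap (a ≡ᵇ b) (a ≡ᵇ c))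
  where
  swap : ∀ x y {r} → (if x then false else (if y then false else r)) ≡ (if y then false else (if x then false else r))
  swap true  true  = refl
  swap true  false = refl
  swap false true  = refl
  swap false false = refl

countLess-sortDesc : ∀ a js → countLess a (sortDesc js) ≡ countLess a js
countLess-sortDesc a = FoldInvariance.sortDesc-invariant (countLess a) (λ b n → (if a <ᵇ b then 1 else 0) ℕ.+ n)
  (λ _ _ → refl) (λ b c → x∙yz≈y∙xz (if a <ᵇ b then 1 else 0) (if a <ᵇ c then 1 else 0))

notIn-above : ∀ {a s} → All (_< a) s → notIn a s ≡ true
notIn-above []           = refl
notIn-above (b<a ∷ s<a) rewrite ≡ᵇ-false (ℕP.>⇒≢ b<a) = notIn-above s<a

countLess-above : ∀ {a s} → All (_< a) s → countLess a s ≡ 0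
countLess-above []           = refl
countLess-above (b<a ∷ s<a) rewrite <ᵇ-false (ℕP.<⇒≤ b<a) = countLess-above s<a

Alternating : (List ℕ → ℚ) → Set
Alternating F = ∀ pre a b post → F (pre ++ a ∷ b ∷ post) ≡ - F (pre ++ b ∷ a ∷ post)

neg-if : ∀ t c (X : ℚ) → - (if t then c * X else 0ℚ) ≡ (if t then (- 1ℚ * c) * X else 0ℚ)
neg-if true  c X = solve 2 (λ c x → :- (c :* x) := (:- con 1ℚ :* c) :* x) refl c X
neg-if false c X = refl

alternating-insertDesc : ∀ (F : List ℕ → ℚ) → Alternating F → ∀ a s → Descending s →
  F (a ∷ s) ≡ (if notIn a s then sgnℚ (countLess a s) * F (insertDesc a s) else 0ℚ)
alternating-insertDesc F alt a []      []         = sym (ℚP.*-identityˡ (F (a ∷ [])))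
alternating-insertDesc F alt a (b ∷ s) (b≥s ∷ ds) with ℕP.<-cmp a b
... | tri< a<b _ _
  rewrite ≡ᵇ-false (ℕP.<⇒≢ a<b) | <ᵇ-true a<b | <ᵇ-false (ℕP.<⇒≤ a<b) = begin
    F (a ∷ b ∷ s)   ≡⟨ alt [] a b s ⟩
    - F (b ∷ a ∷ s) ≡⟨ cong -_ (alternating-insertDesc (F ∘ (b ∷_)) (alt ∘ (b ∷_)) a s ds) ⟩
    - (if notIn a s then sgnℚ (countLess a s) * F (b ∷ insertDesc a s) else 0ℚ)
                    ≡⟨ neg-if (notIn a s) (sgnℚ (countLess a s)) (F (b ∷ insertDesc a s)) ⟩
    (if notIn a s then sgnℚ (suc (countLess a s)) * F (b ∷ insertDesc a s) else 0ℚ) ∎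
    where open ≡-Reasoning
... | tri≈ _ refl _ rewrite ≡ᵇ-refl a = x≡-x⇒x≡0 (F (a ∷ a ∷ s)) (alt [] a a s)
... | tri> _ _ b<a
  rewrite notIn-above (b<a ∷ All.map (λ c≤b → ℕP.≤-<-trans c≤b b<a) b≥s)
        | countLess-above (b<a ∷ All.map (λ c≤b → ℕP.≤-<-trans c≤b b<a) b≥s)
        | <ᵇ-true b<a = sym (ℚP.*-identityˡ (F (a ∷ b ∷ s)))

if-∧ : ∀ d n (c₁ c₂ X : ℚ) →
  (if d then c₁ * (if n then c₂ * X else 0ℚ) else 0ℚ) ≡ (if n ∧ d then (c₂ * c₁) * X else 0ℚ)
if-∧ false false c₁ c₂ X = refl
if-∧ false true  c₁ c₂ X = refl
if-∧ true  false c₁ c₂ X = ℚP.*-zeroʳ c₁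
if-∧ true  true  c₁ c₂ X = solve 3 (λ a b x → a :* (b :* x) := (b :* a) :* x) refl c₁ c₂ X

alternating-sortDesc : ∀ (F : List ℕ → ℚ) → Alternating F → ∀ js →
  F js ≡ (if allDistinct js then sgnℚ (inversions js) * F (sortDesc js) else 0ℚ)
alternating-sortDesc F alt []      = sym (ℚP.*-identityˡ (F []))
alternating-sortDesc F alt (a ∷ t) = begin
  F (a ∷ t)
    ≡⟨ alternating-sortDesc (F ∘ (a ∷_)) (alt ∘ (a ∷_)) t ⟩
  (if allDistinct t then sgnℚ (inversions t) * F (a ∷ s) else 0ℚ)
    ≡⟨ cong (λ y → if allDistinct t then sgnℚ (inversions t) * y else 0ℚ) insert-head ⟩
  (if allDistinct t then sgnℚ (inversions t) * (if notIn a t then sgnℚ (countLess a t) * X else 0ℚ) else 0ℚ)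
    ≡⟨ if-∧ (allDistinct t) (notIn a t) (sgnℚ (inversions t)) (sgnℚ (countLess a t)) X ⟩
  (if notIn a t ∧ allDistinct t then sgnℚ (countLess a t) * sgnℚ (inversions t) * X else 0ℚ)
    ≡⟨ cong (λ c → if notIn a t ∧ allDistinct t then c * X else 0ℚ)
         (pow-+ (- 1ℚ) (countLess a t) (inversions t)) ⟨
  (if notIn a t ∧ allDistinct t then sgnℚ (countLess a t ℕ.+ inversions t) * X else 0ℚ) ∎
  where
  open ≡-Reasoning
  s = sortDesc t
  X = F (insertDesc a s)
  insert-head : F (a ∷ s) ≡ (if notIn a t then sgnℚ (countLess a t) * X else 0ℚ)
  insert-head = subst₂ (λ n c → F (a ∷ s) ≡ (if n then sgnℚ c * X else 0ℚ))
    (notIn-sortDesc a t) (countLess-sortDesc a t)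
    (alternating-insertDesc F alt a s (sortDesc-descending t))

sumℚ-upTo-head-0 : ∀ (f : ℕ → ℚ) n → f 0 ≡ 0ℚ →
  sumℚ (map f (upTo (suc n))) ≡ sumℚ (map (f ∘ suc) (upTo n))
sumℚ-upTo-head-0 f n f0≡0 = begin
  sumℚ (map f (upTo (suc n)))               ≡⟨ cong sumℚ (map-upTo f (suc n)) ⟩
  f 0 + sumℚ (applyUpTo (f ∘ suc) n)        ≡⟨ cong (_+ sumℚ (applyUpTo (f ∘ suc) n)) f0≡0 ⟩
  0ℚ + sumℚ (applyUpTo (f ∘ suc) n)         ≡⟨ ℚP.+-identityˡ _ ⟩
  sumℚ (applyUpTo (f ∘ suc) n)              ≡⟨ cong sumℚ (map-upTo (f ∘ suc) n) ⟨
  sumℚ (map (f ∘ suc) (upTo n))             ∎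
  where open ≡-Reasoning

sumℚ-upTo-last-0 : ∀ (f : ℕ → ℚ) n → f n ≡ 0ℚ →
  sumℚ (map f (upTo (suc n))) ≡ sumℚ (map f (upTo n))
sumℚ-upTo-last-0 f n fn≡0 = begin
  sumℚ (map f (upTo (suc n)))          ≡⟨ cong (sumℚ ∘ map f) (upTo-∷ʳ n) ⟨
  sumℚ (map f (upTo n ++ [ n ]))       ≡⟨ cong sumℚ (map-++ f (upTo n) [ n ]) ⟩
  sumℚ (map f (upTo n) ++ [ f n ])     ≡⟨ sumℚ-++ (map f (upTo n)) [ f n ] ⟩
  sumℚ (map f (upTo n)) + (f n + 0ℚ)   ≡⟨ cong (λ x → sumℚ (map f (upTo n)) + (x + 0ℚ)) fn≡0 ⟩
  sumℚ (map f (upTo n)) + 0ℚ           ≡⟨ ℚP.+-identityʳ _ ⟩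
  sumℚ (map f (upTo n))                ∎
  where open ≡-Reasoning

T-above : ∀ {k j} → k < j → T k j ≡ 0
T-above {zero}  {suc j} _         = refl
T-above {suc k} {suc j} (s≤s k<j) rewrite T-above (ℕP.m<n⇒m<1+n k<j) | T-above k<j =
  trans (ℕP.+-identityʳ (suc j ℕ.* 0)) (ℕP.*-zeroʳ (suc j))

ℕtoℚ-T-suc : ∀ k j → ℕtoℚ (T (suc k) (suc j)) ≡ ℕtoℚ (suc j) * ℕtoℚ (T k (suc j)) + ℕtoℚ (T k j)
ℕtoℚ-T-suc k j = trans (ℕtoℚ-+ (suc j ℕ.* T k (suc j)) (T k j))
  (cong (_+ ℕtoℚ (T k j)) (ℕtoℚ-* (suc j) (T k (suc j))))

stirling-upTo : ∀ k y → pow y k ≡ sumℚ (map (λ j → ℕtoℚ (T k j) * falling y j) (upTo (suc k)))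
stirling-upTo zero    y = refl
stirling-upTo (suc k) y = begin
  y * pow y k
    ≡⟨ cong (y *_) (stirling-upTo k y) ⟩
  y * Σ (λ j → t j * f j)
    ≡⟨ sumℚ-map-*ˡ y (λ j → t j * f j) (upTo (suc k)) ⟨
  Σ (λ j → y * (t j * f j))
    ≡⟨ sumℚ-cong (λ j → solve 4 (λ y t f n → y :* (t :* f) := t :* (f :* (y :- n)) :+ n :* t :* f) refl
         y (t j) (f j) (ℕtoℚ j)) (upTo (suc k)) ⟩
  Σ (λ j → t j * f (suc j) + ℕtoℚ j * t j * f j)
    ≡⟨ sumℚ-map-+ (λ j → t j * f (suc j)) (λ j → ℕtoℚ j * t j * f j) (upTo (suc k)) ⟩
  Σ (λ j → t j * f (suc j)) + Σ (λ j → ℕtoℚ j * t j * f j)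
    ≡⟨ cong (Σ (λ j → t j * f (suc j)) +_) shifted ⟩
  Σ (λ j → t j * f (suc j)) + Σ (λ j → ℕtoℚ (suc j) * t (suc j) * f (suc j))
    ≡⟨ sumℚ-map-+ (λ j → t j * f (suc j)) (λ j → ℕtoℚ (suc j) * t (suc j) * f (suc j)) (upTo (suc k)) ⟨
  Σ (λ j → t j * f (suc j) + ℕtoℚ (suc j) * t (suc j) * f (suc j))
    ≡⟨ sumℚ-cong recurrence (upTo (suc k)) ⟩
  Σ (λ j → ℕtoℚ (T (suc k) (suc j)) * f (suc j))
    ≡⟨ sumℚ-upTo-head-0 (λ j → ℕtoℚ (T (suc k) j) * f j) (suc k) refl ⟨
  sumℚ (map (λ j → ℕtoℚ (T (suc k) j) * f j) (upTo (suc (suc k)))) ∎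
  where
  open ≡-Reasoning
  Σ : (ℕ → ℚ) → ℚ
  Σ g = sumℚ (map g (upTo (suc k)))
  t = λ j → ℕtoℚ (T k j)
  f = falling y
  shifted : Σ (λ j → ℕtoℚ j * t j * f j) ≡ Σ (λ j → ℕtoℚ (suc j) * t (suc j) * f (suc j))
  shifted = trans
    (sym (sumℚ-upTo-last-0 (λ j → ℕtoℚ j * t j * f j) (suc k)
      (trans (cong (λ n → ℕtoℚ (suc k) * ℕtoℚ n * f (suc k)) (T-above (ℕP.n<1+n k)))
             (solve 2 (λ a b → a :* con 0ℚ :* b := con 0ℚ) refl (ℕtoℚ (suc k)) (f (suc k))))))
    (sumℚ-upTo-head-0 (λ j → ℕtoℚ j * t j * f j) (suc k)
      (solve 2 (λ a b → con 0ℚ :* a :* b := con 0ℚ) refl (t 0) (f 0)))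
  recurrence : ∀ j →
    t j * f (suc j) + ℕtoℚ (suc j) * t (suc j) * f (suc j) ≡ ℕtoℚ (T (suc k) (suc j)) * f (suc j)
  recurrence j = trans
    (solve 4 (λ a b c x → c :* x :+ a :* b :* x := (a :* b :+ c) :* x) refl
      (ℕtoℚ (suc j)) (t (suc j)) (t j) (f (suc j)))
    (cong (_* f (suc j)) (sym (ℕtoℚ-T-suc k j)))

stirling : ∀ a → 0 < a → ∀ y → pow y a ≡ sumℚ (map (λ j → ℕtoℚ (T a j) * falling y j) (applyUpTo suc a))
stirling (suc a) _ y = begin
  pow y (suc a)                                    ≡⟨ stirling-upTo (suc a) y ⟩
  sumℚ (map g (upTo (suc (suc a))))                ≡⟨ sumℚ-upTo-head-0 g (suc a) refl ⟩
  sumℚ (map (g ∘ suc) (upTo (suc a)))              ≡⟨ cong sumℚ (map-upTo (g ∘ suc) (suc a)) ⟩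
  sumℚ (applyUpTo (g ∘ suc) (suc a))               ≡⟨ cong sumℚ (map-applyUpTo suc g (suc a)) ⟨
  sumℚ (map g (applyUpTo suc (suc a)))             ∎
  where
  open ≡-Reasoning
  g = λ j → ℕtoℚ (T (suc a) j) * falling y j

prodℚ-map-swapAt : ∀ k (f : ℚ → ℚ) r → prodℚ (map f (swapAt k r)) ≡ prodℚ (map f r)
prodℚ-map-swapAt zero    f []          = refl
prodℚ-map-swapAt zero    f (a ∷ [])    = refl
prodℚ-map-swapAt zero    f (a ∷ b ∷ r) =
  solve 3 (λ x y z → y :* (x :* z) := x :* (y :* z)) refl (f a) (f b) (prodℚ (map f r))
prodℚ-map-swapAt (suc k) f []          = refl
prodℚ-map-swapAt (suc k) f (y ∷ r)     = cong (f y *_) (prodℚ-map-swapAt k f r)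

crossFactor : ℚ → ℚ → ℚ
crossFactor y z = (y + z) ÷' (y - z)

crossFactor-anti : ∀ y z → crossFactor z y ≡ - crossFactor y z
crossFactor-anti y z = trans
  (cong₂ _÷'_ (ℚP.+-comm z y) (solve 2 (λ y z → z :- y := :- (y :- z)) refl y z))
  (÷'-neg (y + z) (y - z))

crossProduct : ℚ → List ℚ → ℚ
crossProduct y r = prodℚ (map (crossFactor y) r)

summand-swap : ∀ pw pre a b post ys →
  summand pw (pre ++ a ∷ b ∷ post) ys ≡ - summand pw (pre ++ b ∷ a ∷ post) (swapAt (length pre) ys)
summand-swap pw []        a b post []          = refl
summand-swap pw []        a b post (y ∷ [])    =
  solve 2 (λ p q → p :* con 1ℚ :* con 0ℚ := :- (q :* con 1ℚ :* con 0ℚ)) refl (pw y a) (pw y b)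
summand-swap pw []        a b post (y ∷ z ∷ r) = begin
  pw y a * (crossFactor y z * crossProduct y r) * (pw z b * crossProduct z r * S)
    ≡⟨ solve 6 (λ A B F P Q S → A :* (F :* P) :* (B :* Q :* S) := :- (B :* ((:- F) :* Q) :* (A :* P :* S))) refl
         (pw y a) (pw z b) (crossFactor y z) (crossProduct y r) (crossProduct z r) S ⟩
  - (pw z b * (- crossFactor y z * crossProduct z r) * (pw y a * crossProduct y r * S))
    ≡⟨ cong (λ c → - (pw z b * (c * crossProduct z r) * (pw y a * crossProduct y r * S))) (crossFactor-anti y z) ⟨
  - (pw z b * (crossFactor z y * crossProduct z r) * (pw y a * crossProduct y r * S)) ∎
  where
  open ≡-Reasoning
  S = summand pw post r
summand-swap pw (c ∷ pre) a b post []          = refl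
summand-swap pw (c ∷ pre) a b post (y ∷ r)     = begin
  pw y c * crossProduct y r * summand pw (pre ++ a ∷ b ∷ post) r
    ≡⟨ cong₂ (λ u v → pw y c * u * v)
         (sym (prodℚ-map-swapAt (length pre) (crossFactor y) r)) (summand-swap pw pre a b post r) ⟩
  pw y c * crossProduct y r′ * - summand pw (pre ++ b ∷ a ∷ post) r′
    ≡⟨ ℚP.neg-distribʳ-* (pw y c * crossProduct y r′) (summand pw (pre ++ b ∷ a ∷ post) r′) ⟨
  - (pw y c * crossProduct y r′ * summand pw (pre ++ b ∷ a ∷ post) r′) ∎
  where
  open ≡-Reasoning
  r′ = swapAt (length pre) r

symmetrizeFactor : List ℚ → ℕ → ℚ
symmetrizeFactor xs l =
  if length xs <ᵇ l then 0ℚ else (ℤ.+ 1 / ((length xs ∸ l) !)) {{(length xs ∸ l) !≢0}}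

symmetrize≡factor*permSum : ∀ pw λs xs →
  symmetrize pw λs xs ≡ symmetrizeFactor xs (length λs) * permSum xs (summand pw λs)
symmetrize≡factor*permSum pw λs xs with length xs <ᵇ length λs
... | true  = sym (ℚP.*-zeroˡ (permSum xs (summand pw λs)))
... | false = refl

symmetrize-alternating : ∀ pw xs → Alternating (λ js → symmetrize pw js xs)
symmetrize-alternating pw xs pre a b post = begin
  symmetrize pw (pre ++ a ∷ b ∷ post) xs
    ≡⟨ symmetrize≡factor*permSum pw (pre ++ a ∷ b ∷ post) xs ⟩
  symmetrizeFactor xs (length (pre ++ a ∷ b ∷ post)) * permSum xs (summand pw (pre ++ a ∷ b ∷ post))
    ≡⟨ cong₂ (λ l s → symmetrizeFactor xs l * s) same-length swapped ⟩
  symmetrizeFactor xs (length ba) * - permSum xs (summand pw ba)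
    ≡⟨ ℚP.neg-distribʳ-* (symmetrizeFactor xs (length ba)) (permSum xs (summand pw ba)) ⟨
  - (symmetrizeFactor xs (length ba) * permSum xs (summand pw ba))
    ≡⟨ cong -_ (symmetrize≡factor*permSum pw ba xs) ⟨
  - symmetrize pw ba xs ∎
  where
  open ≡-Reasoning
  ba = pre ++ b ∷ a ∷ post
  same-length : length (pre ++ a ∷ b ∷ post) ≡ length ba
  same-length = trans (length-++ pre) (sym (length-++ pre))
  swapped : permSum xs (summand pw (pre ++ a ∷ b ∷ post)) ≡ - permSum xs (summand pw ba)
  swapped = begin
    permSum xs (summand pw (pre ++ a ∷ b ∷ post))
      ≡⟨ permSum-cong xs (summand-swap pw pre a b post) ⟩
    permSum xs (λ ys → - summand pw ba (swapAt (length pre) ys))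
      ≡⟨ sumℚ-map-neg (summand pw ba ∘ swapAt (length pre)) (permutations xs) ⟩
    - permSum xs (summand pw ba ∘ swapAt (length pre))
      ≡⟨ cong -_ (permSum-swapAt (length pre) xs (summand pw ba)) ⟩
    - permSum xs (summand pw ba) ∎

sumℚ-boxes-∷ : ∀ (F : List ℕ → ℚ) a as →
  sumℚ (map F (boxes (a ∷ as))) ≡ sumℚ (map (λ j → sumℚ (map (F ∘ (j ∷_)) (boxes as))) (applyUpTo suc a))
sumℚ-boxes-∷ F a as = trans (sumℚ-map-concatMap F (λ j → map (j ∷_) (boxes as)) (applyUpTo suc a))
  (sumℚ-cong (λ j → sumℚ-map-∘ F (j ∷_) (boxes as)) (applyUpTo suc a))

summand-pow-expansion : ∀ λs → All (0 <_) λs → ∀ ys →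
  summand pow λs ys ≡ sumℚ (map (λ js → stirlingProd λs js * summand falling js ys) (boxes λs))
summand-pow-expansion []       []         ys      = refl
summand-pow-expansion (a ∷ as) (_ ∷ _)    []      = sym (trans (sumℚ-boxes-∷ _ a as)
  (sumℚ-map-0 (λ j → sumℚ-map-0 (λ js → ℚP.*-zeroʳ (ℕtoℚ (T a j) * stirlingProd as js)) (boxes as))
    (applyUpTo suc a)))
summand-pow-expansion (a ∷ as) (0<a ∷ 0<as) (y ∷ r) = begin
  pow y a * P * summand pow as r
    ≡⟨ cong₂ (λ u v → u * P * v) (stirling a 0<a y) (summand-pow-expansion as 0<as r) ⟩
  sumℚ (map (λ j → t j * f j) U) * P * sumℚ (map v (boxes as))
    ≡⟨ cong (_* sumℚ (map v (boxes as))) (sumℚ-map-*ʳ P (λ j → t j * f j) U) ⟨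
  sumℚ (map (λ j → t j * f j * P) U) * sumℚ (map v (boxes as))
    ≡⟨ sumℚ-*-sumℚ (λ j → t j * f j * P) v U (boxes as) ⟩
  sumℚ (map (λ j → sumℚ (map (λ js → t j * f j * P * v js) (boxes as))) U)
    ≡⟨ sumℚ-cong (λ j → sumℚ-cong (λ js →
         solve 5 (λ t f p s x → t :* f :* p :* (s :* x) := (t :* s) :* (f :* p :* x)) refl
           (t j) (f j) P (stirlingProd as js) (summand falling js r)) (boxes as)) U ⟩
  sumℚ (map (λ j → sumℚ (map (λ js → w (j ∷ js)) (boxes as))) U)
    ≡⟨ sumℚ-boxes-∷ w a as ⟨
  sumℚ (map w (boxes (a ∷ as))) ∎
  where
  open ≡-Reasoning
  U = applyUpTo suc a
  P = crossProduct y r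
  t = λ j → ℕtoℚ (T a j)
  f = falling y
  v = λ js → stirlingProd as js * summand falling js r
  w = λ js → stirlingProd (a ∷ as) js * summand falling js (y ∷ r)

boxes-length : ∀ λs → All (λ js → length js ≡ length λs) (boxes λs)
boxes-length []       = refl ∷ []
boxes-length (a ∷ as) =
  concat⁺ (map⁺ (All.tabulate {xs = applyUpTo suc a} λ {j} _ →
    map⁺ {f = j ∷_} (All.map (cong suc) (boxes-length as))))

factor*permSum≡SchurP* : ∀ xs js {l} → length js ≡ l →
  symmetrizeFactor xs l * permSum xs (summand falling js) ≡ SchurP* js xs
factor*permSum≡SchurP* xs js len = trans
  (cong (λ l → symmetrizeFactor xs l * permSum xs (summand falling js)) (sym len))
  (sym (symmetrize≡factor*permSum falling js xs))

proposition2p7 : (λs : List ℕ) → StrictPartition λs →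
    (xs : List ℚ) → Unique xs →
    SchurP λs xs ≡ rhs λs xs
proposition2p7 λs (_ , parts-positive) xs _ = begin
  SchurP λs xs
    ≡⟨ symmetrize≡factor*permSum pow λs xs ⟩
  c * permSum xs (summand pow λs)
    ≡⟨ cong (c *_) (permSum-cong xs (summand-pow-expansion λs parts-positive)) ⟩
  c * permSum xs (λ ys → sumℚ (map (λ js → stirlingProd λs js * summand falling js ys) (boxes λs)))
    ≡⟨ permSum-linear xs c (stirlingProd λs) (summand falling) (boxes λs) ⟩
  sumℚ (map (λ js → stirlingProd λs js * (c * permSum xs (summand falling js))) (boxes λs))
    ≡⟨ cong sumℚ (map-cong-local (All.map
         (λ {js} len → cong (stirlingProd λs js *_) (factor*permSum≡SchurP* xs js len)) (boxes-length λs))) ⟩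
  sumℚ (map (λ js → stirlingProd λs js * SchurP* js xs) (boxes λs))
    ≡⟨ sumℚ-cong (λ js → cong (stirlingProd λs js *_)
         (alternating-sortDesc (λ js → SchurP* js xs) (symmetrize-alternating falling xs) js)) (boxes λs) ⟩
  rhs λs xs ∎
  where
  open ≡-Reasoning
  c = symmetrizeFactor xs (length λs)
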